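{- Let $n,k\in\mathbb{N}$, $\mathcal D\subset\{0,1\}^{kn}$, $\varepsilon_1,\varepsilon_2\in(0,1)$, and set $\varepsilon=9(\varepsilon_1+\varepsilon_2k)$; assume $\varepsilon\le1/4$. If $\mathcal V^{k,n}_{\pm\varepsilon_1}(\mathcal D_{\varepsilon_2})\ne\emptyset$, then there exists an injective $f:\{0,1\}^k\to\mathcal D$ such that for all $\alpha,\alpha'\in\{0,1\}^k$, $$r\|\alpha-\alpha'\|_1\le\|f(\alpha)-f(\alpha')\|_1\le r(1+\varepsilon)\|\alpha-\alpha'\|_1,\qquad r:=\frac n2\bigl(1-\varepsilon_1-4\varepsilon_2k\bigr).$$
   Context: $\|x-y\|_1$ is Hamming distance. For $\mathcal D\subseteq\{0,1\}^{m}$ and $\eta\in[0,1]$, $\mathcal D_\eta=\{x\in\{0,1\}^m:\exists x'\in\mathcal D,\ \|x-x'\|_1\le\eta m\}$ (here $m=kn$). For $x\in\{0,1\}^n$, $\mathcal V^n_{\pm\varepsilon_1}(x)=\{x'\in\{0,1\}^n:(1-\varepsilon_1)n/2<\|x-x'\|_1<(1+\varepsilon_1)n/2\}$. Identifying $\{0,1\}^{kn}$ with $(\{0,1\}^n)^k$, for $\mathcal A\subseteq\{0,1\}^{kn}$, $\mathcal V^{k,n}_{\pm\varepsilon_1}(\mathcal A)$ is the set of tuples $(x_0^i,x_1^i)_{i\in[k]}$ of elements of $\{0,1\}^n$ with $x_0^i\in\mathcal V^n_{\pm\varepsilon_1}(x_1^i)$ for all $i$ and $(x^1_{\alpha_1},\dots,x^k_{\alpha_k})\in\mathcal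 A$ for every $\alpha\in\{0,1\}^k$.
   Formalization: The parameters ε₁ and ε₂ range over the rationals in the interval (0,1). -}

module Defs where

open import Data.Bool using (Bool; true; false)
open import Data.Nat using (ℕ; zero; suc; _*_)
open import Data.Integer using (+_)
open import Data.Fin using (Fin)
open import Data.Vec using (Vec; []; _∷_; concat; tabulate; lookup)
open import Data.Rational using (ℚ; _/_; _+_; _-_; _≤_; _<_; 1ℚ; ½)
  renaming (_*_ to _*ℚ_)
open import Data.Product using (Σ; _×_; ∃)
open import Level using (0ℓ)
open import Relation.Unary using (Pred; _∈_)

Bits : ℕ → Set
Bits m = Vec Bool m

ℕ→ℚ : ℕ → ℚ
ℕ→ℚ m = + m / 1

bitDiff : Bool → Bool → ℕ
bitDiff false false = 0
bitDiff true  true  = 0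
bitDiff false true  = 1
bitDiff true  false = 1

hamming : ∀ {m} → Bits m → Bits m → ℕ
hamming []       []       = 0
hamming (a ∷ x)  (b ∷ y)  = bitDiff a b Data.Nat.+ hamming x y

thicken : ∀ {m} → Pred (Bits m) 0ℓ → ℚ → Pred (Bits m) 0ℓ
thicken {m} D η x = Σ (Bits m) λ x' → (x' ∈ D) × (ℕ→ℚ (hamming x x') ≤ η *ℚ ℕ→ℚ m)

inV : ∀ {n} → ℚ → Bits n → Bits n → Set
inV {n} ε₁ x x' =
  ((1ℚ - ε₁) *ℚ ℕ→ℚ n *ℚ ½ < ℕ→ℚ (hamming x x'))
  × (ℕ→ℚ (hamming x x') < (1ℚ + ε₁) *ℚ ℕ→ℚ n *ℚ ½)

-- a tuple (x^i_0, x^i_1)_{i ∈ [k]} of elements of {0,1}^n, written as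
-- X i b = x^i_b  (b = false ↦ 0, b = true ↦ 1)
Tuple : ℕ → ℕ → Set
Tuple k n = Fin k → Bool → Bits n

-- (x^1_{α_1}, …, x^k_{α_k}) ∈ {0,1}^{kn}  via the identification
-- {0,1}^{kn} ≅ ({0,1}^n)^k (concatenation of the blocks)
select : ∀ {k n} → Tuple k n → Bits k → Bits (k * n)
select X α = concat (tabulate λ i → X i (lookup α i))

inVkn : ∀ {k n} → ℚ → Pred (Bits (k * n)) 0ℓ → Tuple k n → Set
inVkn {k} {n} ε₁ A X =
  ((i : Fin k) → inV ε₁ (X i true) (X i false))
  × ((α : Bits k) → select X α ∈ A)

{-# OPTIONS --safe #-}
module Submission where

-- Fix X ∈ V^{k,n}_{±ε₁}(D_{ε₂}) and let f(α) ∈ D lie within ε₂kn of the selection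
-- s(α) = (x¹_{α₁}, …, xᵏ_{αₖ}). Blockwise, ‖s(α) − s(α')‖₁ is a sum of ‖α − α'‖₁ distances
-- ‖xⁱ₀ − xⁱ₁‖₁, each within (1 ± ε₁)n/2. Moving both endpoints changes a distance by at most
-- 2ε₂kn, which for α ≠ α' is at most 2ε₂kn‖α − α'‖₁; this yields the lower factor
-- (1 − ε₁)n/2 − 2ε₂kn = r and the upper factor (1 + ε₁ + 4ε₂k)n/2 ≤ r(1 + ε).
-- Since r > 0, f is injective.

open import Defs
open import Data.Nat using (ℕ; _*_)
open import Data.Rational using (ℚ; _/_; _+_; _-_; _≤_; _<_; 0ℚ; 1ℚ; ½)
open import Data.Integer using (+_)
open import Data.Product using (Σ; _×_; ∃)
open import Data.Vec using (Vec)
open import Data.Bool using (Bool)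
open import Level using (0ℓ)
open import Relation.Unary using (Pred; _∈_)
open import Relation.Binary.PropositionalEquality using (_≡_)

open import Data.Bool using (true; false)
open import Data.Bool.Properties using () renaming (_≟_ to _≟ᵇ_)
open import Data.Empty using (⊥-elim)
open import Data.Fin using (Fin; fromℕ<) renaming (zero to fzero; suc to fsuc)
import Data.Integer as ℤ
import Data.Integer.Properties as ℤP
import Data.Nat as Nat
open Nat using (zero; suc; z≤n; s≤s)
import Data.Nat.Properties as NatP
import Data.Nat.Coprimality as Coprime
open import Data.Product using (_,_; proj₁; proj₂)
open import Data.Rational using (mkℚ; *≤*; -_; nonNegative; positive) renaming (_*_ to _·_)
import Data.Rational.Properties as ℚP
open import Data.Rational.Solver using (module +-*-Solver)
open import Data.Vec using ([]; _∷_; _++_)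
open import Data.Vec.Properties using (≡-dec)
open import Function using (_∘_)
open import Relation.Binary.PropositionalEquality using (refl; sym; trans; cong; cong₂; subst; subst₂)
open import Relation.Nullary using (yes; no)

open import Algebra.Properties.CommutativeSemigroup NatP.+-commutativeSemigroup using (interchange)

ℕ→ℚ-mkℚ : ∀ m → ℕ→ℚ m ≡ mkℚ (+ m) 0 (Coprime.sym (Coprime.1-coprimeTo m))
ℕ→ℚ-mkℚ m = ℚP.normalize-coprime (Coprime.sym (Coprime.1-coprimeTo m))

ℕ→ℚ-homo-+ : ∀ a b → ℕ→ℚ (a Nat.+ b) ≡ ℕ→ℚ a + ℕ→ℚ b
ℕ→ℚ-homo-+ a b rewrite ℕ→ℚ-mkℚ a | ℕ→ℚ-mkℚ b =
  cong (_/ 1) (sym (cong₂ ℤ._+_ (ℤP.*-identityʳ (+ a)) (ℤP.*-identityʳ (+ b))))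

ℕ→ℚ-homo-* : ∀ a b → ℕ→ℚ (a Nat.* b) ≡ ℕ→ℚ a · ℕ→ℚ b
ℕ→ℚ-homo-* a b rewrite ℕ→ℚ-mkℚ a | ℕ→ℚ-mkℚ b = cong (_/ 1) (ℤP.pos-* a b)

ℕ→ℚ-mono-≤ : ∀ {a b} → a Nat.≤ b → ℕ→ℚ a ≤ ℕ→ℚ b
ℕ→ℚ-mono-≤ {a} {b} a≤b rewrite ℕ→ℚ-mkℚ a | ℕ→ℚ-mkℚ b =
  *≤* (subst₂ ℤ._≤_ (sym (ℤP.*-identityʳ (+ a))) (sym (ℤP.*-identityʳ (+ b))) (ℤ.+≤+ a≤b))

ℕ→ℚ-nonNeg : ∀ m → 0ℚ ≤ ℕ→ℚ m
ℕ→ℚ-nonNeg m = ℕ→ℚ-mono-≤ (z≤n {m})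

bitDiff-refl : ∀ a → bitDiff a a ≡ 0
bitDiff-refl false = refl
bitDiff-refl true  = refl

bitDiff-sym : ∀ a b → bitDiff a b ≡ bitDiff b a
bitDiff-sym false false = refl
bitDiff-sym false true  = refl
bitDiff-sym true  false = refl
bitDiff-sym true  true  = refl

bitDiff-triangle : ∀ a b c → bitDiff a c Nat.≤ bitDiff a b Nat.+ bitDiff b c
bitDiff-triangle false _     false = z≤n
bitDiff-triangle true  _     true  = z≤n
bitDiff-triangle false false true  = NatP.≤-refl
bitDiff-triangle false true  true  = NatP.≤-refl
bitDiff-triangle true  false false = NatP.≤-refl
bitDiff-triangle true  true  false = NatP.≤-refl

bitDiff≤1 : ∀ a b → bitDiff a b Nat.≤ 1
bitDiff≤1 false false = z≤n
bitDiff≤1 false true  = NatP.≤-refl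
bitDiff≤1 true  false = NatP.≤-refl
bitDiff≤1 true  true  = z≤n

bitDiff≡0⇒≡ : ∀ {a b} → bitDiff a b ≡ 0 → a ≡ b
bitDiff≡0⇒≡ {false} {false} _ = refl
bitDiff≡0⇒≡ {true}  {true}  _ = refl

hamming-refl : ∀ {m} (x : Bits m) → hamming x x ≡ 0
hamming-refl []      = refl
hamming-refl (a ∷ x) = cong₂ Nat._+_ (bitDiff-refl a) (hamming-refl x)

hamming-sym : ∀ {m} (x y : Bits m) → hamming x y ≡ hamming y x
hamming-sym []      []      = refl
hamming-sym (a ∷ x) (b ∷ y) = cong₂ Nat._+_ (bitDiff-sym a b) (hamming-sym x y)

hamming-triangle : ∀ {m} (x y z : Bits m) → hamming x z Nat.≤ hamming x y Nat.+ hamming y z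
hamming-triangle []      []      []      = z≤n
hamming-triangle (a ∷ x) (b ∷ y) (c ∷ z) = NatP.≤-trans
  (NatP.+-mono-≤ (bitDiff-triangle a b c) (hamming-triangle x y z))
  (NatP.≤-reflexive (interchange (bitDiff a b) (bitDiff b c) (hamming x y) (hamming y z)))

hamming≤length : ∀ {m} (x y : Bits m) → hamming x y Nat.≤ m
hamming≤length []      []      = z≤n
hamming≤length (a ∷ x) (b ∷ y) = NatP.+-mono-≤ (bitDiff≤1 a b) (hamming≤length x y)

hamming≡0⇒≡ : ∀ {m} {x y : Bits m} → hamming x y ≡ 0 → x ≡ y
hamming≡0⇒≡ {x = []}    {[]}    _  = refl
hamming≡0⇒≡ {x = a ∷ x} {b ∷ y} eq =
  cong₂ _∷_ (bitDiff≡0⇒≡ (NatP.m+n≡0⇒m≡0 (bitDiff a b) eq)) (hamming≡0⇒≡ (NatP.m+n≡0⇒n≡0 (bitDiff a b) eq))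

hamming-++ : ∀ {p q} (x x' : Bits p) (y y' : Bits q) →
             hamming (x ++ y) (x' ++ y') ≡ hamming x x' Nat.+ hamming y y'
hamming-++ []      []       y y' = refl
hamming-++ (a ∷ x) (b ∷ x') y y' =
  trans (cong (bitDiff a b Nat.+_) (hamming-++ x x' y y')) (sym (NatP.+-assoc (bitDiff a b) _ _))

open ℚP.≤-Reasoning
open +-*-Solver

p≤p+q : ∀ {p q} → 0ℚ ≤ q → p ≤ p + q
p≤p+q {p} {q} 0≤q = begin
  p       ≡⟨ sym (ℚP.+-identityʳ p) ⟩
  p + 0ℚ  ≤⟨ ℚP.+-monoʳ-≤ p 0≤q ⟩
  p + q   ∎

p≤q⇒0≤q-p : ∀ {p q} → p ≤ q → 0ℚ ≤ q - p
p≤q⇒0≤q-p {p} {q} p≤q = begin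
  0ℚ     ≡⟨ sym (ℚP.+-inverseʳ p) ⟩
  p - p  ≤⟨ ℚP.+-monoˡ-≤ (- p) p≤q ⟩
  q - p  ∎

p≤p·q : ∀ {p q} → 0ℚ ≤ p → 1ℚ ≤ q → p ≤ p · q
p≤p·q {p} {q} 0≤p 1≤q = begin
  p       ≡⟨ sym (ℚP.*-identityʳ p) ⟩
  p · 1ℚ  ≤⟨ ℚP.*-monoˡ-≤-nonNeg p {{nonNegative 0≤p}} 1≤q ⟩
  p · q   ∎

0≤p·q : ∀ {p q} → 0ℚ ≤ p → 0ℚ ≤ q → 0ℚ ≤ p · q
0≤p·q {p} {q} 0≤p 0≤q = begin
  0ℚ      ≡⟨ sym (ℚP.*-zeroʳ p) ⟩
  p · 0ℚ  ≤⟨ ℚP.*-monoˡ-≤-nonNeg p {{nonNegative 0≤p}} 0≤q ⟩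
  p · q   ∎

0<p·q : ∀ {p q} → 0ℚ < p → 0ℚ < q → 0ℚ < p · q
0<p·q {p} {q} 0<p 0<q = begin-strict
  0ℚ      ≡⟨ sym (ℚP.*-zeroʳ p) ⟩
  p · 0ℚ  <⟨ ℚP.*-monoʳ-<-pos p {{positive 0<p}} 0<q ⟩
  p · q   ∎

record ScaledBy (L U : ℚ) (d s : ℕ) : Set where
  constructor scaled
  field
    lower : L · ℕ→ℚ d ≤ ℕ→ℚ s
    upper : ℕ→ℚ s ≤ U · ℕ→ℚ d

scaledBy-zero : ∀ {L U} → ScaledBy L U 0 0
scaledBy-zero {L} {U} = scaled (ℚP.≤-reflexive (ℚP.*-zeroʳ L)) (ℚP.≤-reflexive (sym (ℚP.*-zeroʳ U)))

scaledBy-one : ∀ {L U s} → L ≤ ℕ→ℚ s → ℕ→ℚ s ≤ U → ScaledBy L U 1 s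
scaledBy-one {L} {U} {s} L≤s s≤U =
  scaled (subst (_≤ ℕ→ℚ s) (sym (ℚP.*-identityʳ L)) L≤s) (subst (ℕ→ℚ s ≤_) (sym (ℚP.*-identityʳ U)) s≤U)

scaledBy-+ : ∀ {L U d d' s s'} → ScaledBy L U d s → ScaledBy L U d' s' →
             ScaledBy L U (d Nat.+ d') (s Nat.+ s')
scaledBy-+ {L} {U} {d} {d'} {s} {s'} (scaled Ld≤s s≤Ud) (scaled Ld'≤s' s'≤Ud') = scaled lower upper
  where
  lower : L · ℕ→ℚ (d Nat.+ d') ≤ ℕ→ℚ (s Nat.+ s')
  lower = begin
    L · ℕ→ℚ (d Nat.+ d')        ≡⟨ cong (L ·_) (ℕ→ℚ-homo-+ d d') ⟩
    L · (ℕ→ℚ d + ℕ→ℚ d')        ≡⟨ ℚP.*-distribˡ-+ L (ℕ→ℚ d) (ℕ→ℚ d') ⟩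
    L · ℕ→ℚ d + L · ℕ→ℚ d'      ≤⟨ ℚP.+-mono-≤ Ld≤s Ld'≤s' ⟩
    ℕ→ℚ s + ℕ→ℚ s'              ≡⟨ sym (ℕ→ℚ-homo-+ s s') ⟩
    ℕ→ℚ (s Nat.+ s')            ∎
  upper : ℕ→ℚ (s Nat.+ s') ≤ U · ℕ→ℚ (d Nat.+ d')
  upper = begin
    ℕ→ℚ (s Nat.+ s')            ≡⟨ ℕ→ℚ-homo-+ s s' ⟩
    ℕ→ℚ s + ℕ→ℚ s'              ≤⟨ ℚP.+-mono-≤ s≤Ud s'≤Ud' ⟩
    U · ℕ→ℚ d + U · ℕ→ℚ d'      ≡⟨ sym (ℚP.*-distribˡ-+ U (ℕ→ℚ d) (ℕ→ℚ d')) ⟩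
    U · (ℕ→ℚ d + ℕ→ℚ d')        ≡⟨ cong (U ·_) (sym (ℕ→ℚ-homo-+ d d')) ⟩
    U · ℕ→ℚ (d Nat.+ d')        ∎

scaledBy-weaken : ∀ {L L' U U' d s} → L' ≤ L → U ≤ U' → ScaledBy L U d s → ScaledBy L' U' d s
scaledBy-weaken {d = d} L'≤L U≤U' (scaled Ld≤s s≤Ud) =
  scaled (ℚP.≤-trans (*-monoʳ L'≤L) Ld≤s) (ℚP.≤-trans s≤Ud (*-monoʳ U≤U'))
  where
  *-monoʳ : ∀ {p q} → p ≤ q → p · ℕ→ℚ d ≤ q · ℕ→ℚ d
  *-monoʳ = ℚP.*-monoʳ-≤-nonNeg (ℕ→ℚ d) {{nonNegative (ℕ→ℚ-nonNeg d)}}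

scaledBy-injective : ∀ {L U d} → (1 Nat.≤ d → 0ℚ < L) → ScaledBy L U d 0 → d ≡ 0
scaledBy-injective {d = zero} _ _ = refl
scaledBy-injective {L} {d = suc d} 0<L (scaled L·d≤0 _) = ⊥-elim (ℚP.<-irrefl refl (begin-strict
  0ℚ                 <⟨ 0<L (s≤s z≤n) ⟩
  L                  ≤⟨ p≤p·q (ℚP.<⇒≤ (0<L (s≤s z≤n))) (ℕ→ℚ-mono-≤ (s≤s (z≤n {d}))) ⟩
  L · ℕ→ℚ (suc d)    ≤⟨ L·d≤0 ⟩
  0ℚ                 ∎))

scaledBy-block : ∀ {n L U} (x : Bool → Bits n) → ScaledBy L U 1 (hamming (x true) (x false)) →
                 ∀ a b → ScaledBy L U (bitDiff a b) (hamming (x a) (x b))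
scaledBy-block x apart false false rewrite hamming-refl (x false) = scaledBy-zero
scaledBy-block x apart true  true  rewrite hamming-refl (x true)  = scaledBy-zero
scaledBy-block x apart true  false = apart
scaledBy-block x apart false true  rewrite hamming-sym (x false) (x true) = apart

select-scaledBy : ∀ {k n L U} (X : Tuple k n) →
                  (∀ i → ScaledBy L U 1 (hamming (X i true) (X i false))) →
                  ∀ α α' → ScaledBy L U (hamming α α') (hamming (select X α) (select X α'))
select-scaledBy X apart []      []       = scaledBy-zero
select-scaledBy X apart (a ∷ α) (b ∷ α') =
  subst (ScaledBy _ _ (bitDiff a b Nat.+ hamming α α'))
    (sym (hamming-++ (X fzero a) (X fzero b) (select (X ∘ fsuc) α) (select (X ∘ fsuc) α')))
    (scaledBy-+ (scaledBy-block (X fzero) (apart fzero) a b) (select-scaledBy (X ∘ fsuc) (apart ∘ fsuc) α α'))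

hamming-perturb : ∀ {m A} (x x' y y' : Bits m) →
                  ℕ→ℚ (hamming x x') ≤ A → ℕ→ℚ (hamming y y') ≤ A →
                  ℕ→ℚ (hamming x' y') ≤ ℕ→ℚ (hamming x y) + (A + A)
hamming-perturb {A = A} x x' y y' xx'≤A yy'≤A = begin
  ℕ→ℚ (hamming x' y')
    ≤⟨ ℕ→ℚ-mono-≤ (NatP.≤-trans (hamming-triangle x' x y') (NatP.+-monoʳ-≤ (hamming x' x) (hamming-triangle x y y'))) ⟩
  ℕ→ℚ (hamming x' x Nat.+ (hamming x y Nat.+ hamming y y'))
    ≡⟨ trans (ℕ→ℚ-homo-+ (hamming x' x) _) (cong (_+_ (ℕ→ℚ (hamming x' x))) (ℕ→ℚ-homo-+ (hamming x y) (hamming y y'))) ⟩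
  ℕ→ℚ (hamming x' x) + (ℕ→ℚ (hamming x y) + ℕ→ℚ (hamming y y'))
    ≤⟨ ℚP.+-mono-≤ (subst (_≤ A) (cong ℕ→ℚ (hamming-sym x x')) xx'≤A) (ℚP.+-monoʳ-≤ (ℕ→ℚ (hamming x y)) yy'≤A) ⟩
  A + (ℕ→ℚ (hamming x y) + A)
    ≡⟨ solve 2 (λ a h → a :+ (h :+ a) := h :+ (a :+ a)) refl A (ℕ→ℚ (hamming x y)) ⟩
  ℕ→ℚ (hamming x y) + (A + A) ∎

scaledBy-perturb : ∀ {L U A d s t} → 0ℚ ≤ A → 1 Nat.≤ d → ScaledBy L U d s →
                   ℕ→ℚ s ≤ ℕ→ℚ t + (A + A) → ℕ→ℚ t ≤ ℕ→ℚ s + (A + A) →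
                   ScaledBy (L - (A + A)) (U + (A + A)) d t
scaledBy-perturb {L} {U} {A} {d} {s} {t} 0≤A 1≤d (scaled Ld≤s s≤Ud) s≤t+2A t≤s+2A = scaled lower upper
  where
  2A≤2Ad : A + A ≤ (A + A) · ℕ→ℚ d
  2A≤2Ad = p≤p·q (ℚP.+-mono-≤ 0≤A 0≤A) (ℕ→ℚ-mono-≤ 1≤d)
  lower : (L - (A + A)) · ℕ→ℚ d ≤ ℕ→ℚ t
  lower = begin
    (L - (A + A)) · ℕ→ℚ d
      ≡⟨ solve 3 (λ l a d → (l :- (a :+ a)) :* d := l :* d :- (a :+ a) :* d) refl L A (ℕ→ℚ d) ⟩
    L · ℕ→ℚ d - (A + A) · ℕ→ℚ d  ≤⟨ ℚP.+-monoʳ-≤ (L · ℕ→ℚ d) (ℚP.neg-antimono-≤ 2A≤2Ad) ⟩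
    L · ℕ→ℚ d - (A + A)          ≤⟨ ℚP.+-monoˡ-≤ (- (A + A)) (ℚP.≤-trans Ld≤s s≤t+2A) ⟩
    ℕ→ℚ t + (A + A) - (A + A)    ≡⟨ solve 2 (λ t a → t :+ a :- a := t) refl (ℕ→ℚ t) (A + A) ⟩
    ℕ→ℚ t                        ∎
  upper : ℕ→ℚ t ≤ (U + (A + A)) · ℕ→ℚ d
  upper = begin
    ℕ→ℚ t                          ≤⟨ t≤s+2A ⟩
    ℕ→ℚ s + (A + A)                ≤⟨ ℚP.+-mono-≤ s≤Ud 2A≤2Ad ⟩
    U · ℕ→ℚ d + (A + A) · ℕ→ℚ d    ≡⟨ sym (ℚP.*-distribʳ-+ (ℕ→ℚ d) U (A + A)) ⟩
    (U + (A + A)) · ℕ→ℚ d          ∎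

perturbed-select-scaledBy :
  ∀ {k n L U A} (X : Tuple k n) (g : Bits k → Bits (k * n)) → 0ℚ ≤ A →
  (∀ i → ScaledBy L U 1 (hamming (X i true) (X i false))) →
  (∀ α → ℕ→ℚ (hamming (select X α) (g α)) ≤ A) →
  ∀ α α' → ScaledBy (L - (A + A)) (U + (A + A)) (hamming α α') (hamming (g α) (g α'))
perturbed-select-scaledBy {L = L} {U} {A} X g 0≤A apart near α α' with ≡-dec _≟ᵇ_ α α'
... | yes refl rewrite hamming-refl α | hamming-refl (g α) = scaledBy-zero
... | no α≢α' = scaledBy-perturb {L} {U} {A} 0≤A (NatP.n≢0⇒n>0 (α≢α' ∘ hamming≡0⇒≡)) (select-scaledBy X apart α α')
  (hamming-perturb (g α) (select X α) (g α') (select X α') (near′ α) (near′ α'))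
  (hamming-perturb (select X α) (g α) (select X α') (g α') (near α) (near α'))
  where
  near′ : ∀ α → ℕ→ℚ (hamming (g α) (select X α)) ≤ A
  near′ α = subst (_≤ _) (cong ℕ→ℚ (hamming-sym (select X α) (g α))) (near α)

inV⇒n>0 : ∀ {n ε₁} {x y : Bits n} → inV ε₁ x y → 0 Nat.< n
inV⇒n>0 {zero} {ε₁} {[]} {[]} (L<0 , _) =
  ⊥-elim (ℚP.<-irrefl (trans (cong (_· ½) (ℚP.*-zeroʳ (1ℚ - ε₁))) (ℚP.*-zeroˡ ½)) L<0)
inV⇒n>0 {suc n} _ = s≤s z≤n

module Distortion {ε₁ ε₂ K N : ℚ} (0≤ε₁ : 0ℚ ≤ ε₁) (0≤ε₂ : 0ℚ ≤ ε₂) (0≤K : 0ℚ ≤ K) (0≤N : 0ℚ ≤ N)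
                  (budget : (+ 9 / 1) · (ε₁ + ε₂ · K) ≤ + 1 / 4) where

  ε a A r : ℚ
  ε = (+ 9 / 1) · (ε₁ + ε₂ · K)
  a = ε₁ + (+ 4 / 1) · ε₂ · K
  A = ε₂ · (K · N)
  r = N · ½ · (1ℚ - ε₁ - (+ 4 / 1) · ε₂ · K)

  0≤A : 0ℚ ≤ A
  0≤A = 0≤p·q 0≤ε₂ (0≤p·q 0≤K 0≤N)

  0≤a : 0ℚ ≤ a
  0≤a = ℚP.+-mono-≤ 0≤ε₁ (0≤p·q (0≤p·q (ℚP.nonNegative⁻¹ (+ 4 / 1)) 0≤ε₂) 0≤K)

  0≤¼-ε : 0ℚ ≤ + 1 / 4 - ε
  0≤¼-ε = p≤q⇒0≤q-p budget

  -- (1 − a)(1 + ε) − (1 + a) = ε − 2a − aε, and ε = 27ε₁/4 + 9a/4.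
  1+a≤[1-a][1+ε] : 1ℚ + a ≤ (1ℚ - a) · (1ℚ + ε)
  1+a≤[1-a][1+ε] = begin
    1ℚ + a
      ≤⟨ p≤p+q (ℚP.+-mono-≤ 0≤27ε₁/4 (0≤p·q 0≤a 0≤¼-ε)) ⟩
    1ℚ + a + ((+ 27 / 4) · ε₁ + a · (+ 1 / 4 - ε))
      ≡⟨ solve 3 (λ e₁ e₂ k →
           con 1ℚ :+ (e₁ :+ con (+ 4 / 1) :* e₂ :* k)
             :+ (con (+ 27 / 4) :* e₁ :+ (e₁ :+ con (+ 4 / 1) :* e₂ :* k) :* (con (+ 1 / 4) :- con (+ 9 / 1) :* (e₁ :+ e₂ :* k)))
           := (con 1ℚ :- (e₁ :+ con (+ 4 / 1) :* e₂ :* k)) :* (con 1ℚ :+ con (+ 9 / 1) :* (e₁ :+ e₂ :* k)))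
         refl ε₁ ε₂ K ⟩
    (1ℚ - a) · (1ℚ + ε) ∎
    where
    0≤27ε₁/4 : 0ℚ ≤ (+ 27 / 4) · ε₁
    0≤27ε₁/4 = 0≤p·q (ℚP.nonNegative⁻¹ (+ 27 / 4)) 0≤ε₁

  0<1-a : 0ℚ < 1ℚ - a
  0<1-a = begin-strict
    0ℚ       <⟨ ℚP.positive⁻¹ (+ 3 / 4) ⟩
    + 3 / 4  ≤⟨ p≤p+q 0≤rest ⟩
    + 3 / 4 + ((+ 1 / 4 - ε) + (+ 8 / 1) · ε₁ + (+ 5 / 1) · ε₂ · K)
      ≡⟨ solve 3 (λ e₁ e₂ k →
           con (+ 3 / 4) :+ ((con (+ 1 / 4) :- con (+ 9 / 1) :* (e₁ :+ e₂ :* k)) :+ con (+ 8 / 1) :* e₁ :+ con (+ 5 / 1) :* e₂ :* k)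
           := con 1ℚ :- (e₁ :+ con (+ 4 / 1) :* e₂ :* k))
         refl ε₁ ε₂ K ⟩
    1ℚ - a ∎
    where
    0≤rest : 0ℚ ≤ (+ 1 / 4 - ε) + (+ 8 / 1) · ε₁ + (+ 5 / 1) · ε₂ · K
    0≤rest = ℚP.+-mono-≤ (ℚP.+-mono-≤ 0≤¼-ε (0≤p·q (ℚP.nonNegative⁻¹ (+ 8 / 1)) 0≤ε₁))
                         (0≤p·q (0≤p·q (ℚP.nonNegative⁻¹ (+ 5 / 1)) 0≤ε₂) 0≤K)

  r≡N½[1-a] : r ≡ N · ½ · (1ℚ - a)
  r≡N½[1-a] = solve 4 (λ e₁ e₂ k n →
      n :* con ½ :* (con 1ℚ :- e₁ :- con (+ 4 / 1) :* e₂ :* k)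
      := n :* con ½ :* (con 1ℚ :- (e₁ :+ con (+ 4 / 1) :* e₂ :* k)))
    refl ε₁ ε₂ K N

  L-2A≡r : (1ℚ - ε₁) · N · ½ - (A + A) ≡ r
  L-2A≡r = solve 4 (λ e₁ e₂ k n →
      (con 1ℚ :- e₁) :* n :* con ½ :- (e₂ :* (k :* n) :+ e₂ :* (k :* n))
      := n :* con ½ :* (con 1ℚ :- e₁ :- con (+ 4 / 1) :* e₂ :* k))
    refl ε₁ ε₂ K N

  U+2A≤r[1+ε] : (1ℚ + ε₁) · N · ½ + (A + A) ≤ r · (1ℚ + ε)
  U+2A≤r[1+ε] = begin
    (1ℚ + ε₁) · N · ½ + (A + A)
      ≡⟨ solve 4 (λ e₁ e₂ k n →
           (con 1ℚ :+ e₁) :* n :* con ½ :+ (e₂ :* (k :* n) :+ e₂ :* (k :* n))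
           := n :* con ½ :* (con 1ℚ :+ (e₁ :+ con (+ 4 / 1) :* e₂ :* k)))
         refl ε₁ ε₂ K N ⟩
    N · ½ · (1ℚ + a)            ≤⟨ ℚP.*-monoˡ-≤-nonNeg (N · ½) {{nonNegative 0≤N½}} 1+a≤[1-a][1+ε] ⟩
    N · ½ · ((1ℚ - a) · (1ℚ + ε)) ≡⟨ sym (ℚP.*-assoc (N · ½) (1ℚ - a) (1ℚ + ε)) ⟩
    N · ½ · (1ℚ - a) · (1ℚ + ε)   ≡⟨ cong (_· (1ℚ + ε)) (sym r≡N½[1-a]) ⟩
    r · (1ℚ + ε)                  ∎
    where
    0≤N½ : 0ℚ ≤ N · ½
    0≤N½ = 0≤p·q 0≤N (ℚP.nonNegative⁻¹ ½)

  N>0⇒r>0 : 0ℚ < N → 0ℚ < r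
  N>0⇒r>0 0<N = subst (0ℚ <_) (sym r≡N½[1-a]) (0<p·q (0<p·q 0<N (ℚP.positive⁻¹ ½)) 0<1-a)

mainTheorem12 :
  (n k : ℕ) (D : Pred (Bits (k * n)) 0ℓ) (ε₁ ε₂ : ℚ) →
  0ℚ < ε₁ → ε₁ < 1ℚ → 0ℚ < ε₂ → ε₂ < 1ℚ →
  ((+ 9 / 1) Data.Rational.* (ε₁ + ε₂ Data.Rational.* ℕ→ℚ k) ≤ + 1 / 4) →
  ∃ (λ (X : Tuple k n) → inVkn ε₁ (thicken D ε₂) X) →
  Σ (Bits k → Bits (k * n)) λ f →
    ((α : Bits k) → f α ∈ D)
    × ((α α' : Bits k) → f α ≡ f α' → α ≡ α')
    × ((α α' : Bits k) →
        let ε = (+ 9 / 1) Data.Rational.* (ε₁ + ε₂ Data.Rational.* ℕ→ℚ k)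
            r = ℕ→ℚ n Data.Rational.* ½ Data.Rational.*
                  (1ℚ - ε₁ - (+ 4 / 1) Data.Rational.* ε₂ Data.Rational.* ℕ→ℚ k)
        in (r Data.Rational.* ℕ→ℚ (hamming α α') ≤ ℕ→ℚ (hamming (f α) (f α')))
           × (ℕ→ℚ (hamming (f α) (f α'))
                ≤ r Data.Rational.* (1ℚ + ε) Data.Rational.* ℕ→ℚ (hamming α α')))
mainTheorem12 n k D ε₁ ε₂ 0<ε₁ _ 0<ε₂ _ budget (X , apart , nearD) =
  f , f∈D , f-injective , λ α α' → ScaledBy.lower (f-scaledBy α α') , ScaledBy.upper (f-scaledBy α α')
  where
  -- The unused hypotheses ε₁ < 1 and ε₂ < 1 follow from ε ≤ 1/4.
  open Distortion (ℚP.<⇒≤ 0<ε₁) (ℚP.<⇒≤ 0<ε₂) (ℕ→ℚ-nonNeg k) (ℕ→ℚ-nonNeg n) budget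

  f : Bits k → Bits (k * n)
  f α = proj₁ (nearD α)

  f∈D : ∀ α → f α ∈ D
  f∈D α = proj₁ (proj₂ (nearD α))

  f-near : ∀ α → ℕ→ℚ (hamming (select X α) (f α)) ≤ A
  f-near α = subst (_ ≤_) (cong (ε₂ ·_) (ℕ→ℚ-homo-* k n)) (proj₂ (proj₂ (nearD α)))

  blocks : ∀ i → ScaledBy ((1ℚ - ε₁) · ℕ→ℚ n · ½) ((1ℚ + ε₁) · ℕ→ℚ n · ½) 1 (hamming (X i true) (X i false))
  blocks i = scaledBy-one (ℚP.<⇒≤ (proj₁ (apart i))) (ℚP.<⇒≤ (proj₂ (apart i)))

  f-scaledBy : ∀ α α' → ScaledBy r (r · (1ℚ + ε)) (hamming α α') (hamming (f α) (f α'))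
  f-scaledBy α α' = scaledBy-weaken (ℚP.≤-reflexive (sym L-2A≡r)) U+2A≤r[1+ε]
    (perturbed-select-scaledBy X f 0≤A blocks f-near α α')

  f-injective : ∀ α α' → f α ≡ f α' → α ≡ α'
  f-injective α α' fα≡fα' = hamming≡0⇒≡ (scaledBy-injective 0<r
    (subst (ScaledBy _ _ _) (trans (cong (hamming (f α)) (sym fα≡fα')) (hamming-refl (f α))) (f-scaledBy α α')))
    where
    0<r : 1 Nat.≤ hamming α α' → 0ℚ < r
    0<r 1≤d = N>0⇒r>0 (ℚP.<-≤-trans (ℚP.positive⁻¹ 1ℚ) (ℕ→ℚ-mono-≤ (inV⇒n>0 {ε₁ = ε₁} {X i true} (apart i))))
      where
      i : Fin k
      i = fromℕ< (NatP.≤-trans 1≤d (hamming≤length α α'))
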